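{- Let $p\geqslant 3$ be an odd prime and let $S\subseteq D_{2p}$ satisfy $1\notin S$, $S=S^{ -1}$ and $\langle S\rangle=D_{2p}$. Let $S_2=S\cap \beta\langle\alpha\rangle$. If $|S_2|=1$, then the Cayley graph $Cay(D_{2p},S)$ has a Hamilton decomposition.
   Context: For $n\geqslant 2$, the dihedral group $D_{2n}$ is the group generated by two elements $\alpha,\beta$ subject to $\alpha^n=\beta^2=1$ and $\beta\alpha\beta=\alpha^{ -1}$; $\beta\langle\alpha\rangle=\{\beta\alpha^i\}$ is the coset of reflections. For a group $G$ and a subset $S\subseteq G$ with $1\notin S$, $S=S^{ -1}$ and $\langle S\rangle=G$, the Cayley graph $Cay(G,S)$ is the simple graph with vertex set $G$ in which $g,h\in G$ are adjacent iff $hg^{ -1}\in S$; it is regular of valency $|S|$. A regular graph of valency $2k$ has a Hamilton decomposition if its edge set can be partitioned into $k$ Hamilton cycles; a regular graph of valency $2k-1$ has a Hamilton decomposition if its edge set can be partitioned into $k-1$ Hamilton cycles and a perfect matching. -}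

module Defs where

open import Data.Nat using (ℕ; zero; suc; _+_; _*_; _∸_)
open import Data.Nat.DivMod using (_mod_)
open import Data.Fin using (Fin; toℕ)
open import Data.Bool using (Bool; true; false; _xor_; _∧_; if_then_else_)
open import Data.Product using (Σ; Σ-syntax; _×_; _,_; proj₁)
open import Data.Sum using (_⊎_)
open import Data.Maybe using (Maybe; just; nothing)
open import Data.List using (List; length; map; _++_; filterᵇ; allFin)
open import Relation.Binary.PropositionalEquality using (_≡_)
open import Relation.Nullary using (¬_)

addF : ∀ {n} → Fin n → Fin n → Fin n
addF {suc m} i j = (toℕ i + toℕ j) mod (suc m)

negF : ∀ {n} → Fin n → Fin n
negF {suc m} i = (suc m ∸ toℕ i) mod (suc m)

oneF : ∀ {n} → Fin n → Fin n
oneF {suc m} i = (suc (toℕ i)) mod (suc m)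

zeroF : ∀ {n} → Fin (suc n)
zeroF = Data.Fin.zero

-- The dihedral group D_{2n}: the pair (b , i) represents β^b α^i
-- (b = false: rotation α^i; b = true: reflection βα^i).
D : ℕ → Set
D n = Bool × Fin n

-- Using α^i β = β α^{-i}:  (β^a α^i)(β^b α^j) = β^(a+b) α^((-1)^b i + j).
_·_ : ∀ {n} → D n → D n → D n
(a , i) · (b , j) = (a xor b , addF (if b then negF i else i) j)

inv : ∀ {n} → D n → D n
inv (false , i) = (false , negF i)
inv (true , i) = (true , i)

e : ∀ {n} → D (suc n)
e = (false , zeroF)

elems : (n : ℕ) → List (D n)
elems n = map (false ,_) (allFin n) ++ map (true ,_) (allFin n)

card : ∀ {n} → (D n → Bool) → ℕ
card {n} S = length (filterᵇ S (elems n))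

reflPart : ∀ {n} → (D n → Bool) → (D n → Bool)
reflPart S g = S g ∧ proj₁ g

data InGen {n : ℕ} (S : D (suc n) → Bool) : D (suc n) → Set where
  gen-one : InGen S e
  gen-mul : ∀ {s g} → S s ≡ true → InGen S g → InGen S (s · g)
  gen-inv : ∀ {s g} → S s ≡ true → InGen S g → InGen S (inv s · g)

Generates : ∀ {n} → (D (suc n) → Bool) → Set
Generates S = ∀ g → InGen S g

CayAdj : ∀ {n} → (D n → Bool) → D n → D n → Set
CayAdj S g h = S (h · inv g) ≡ true

-- A Hamilton cycle is an injective
-- (hence bijective when N = |V|) map c : Fin N → V with c i ~ c (i+1 mod N).
module _ {V : Set} (N : ℕ) (Adj : V → V → Set) where

  record HamCycle : Set where
    field
      cyc : Fin N → V
      inj : ∀ a b → cyc a ≡ cyc b → a ≡ b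
      adj : ∀ a → Adj (cyc a) (cyc (oneF a))

  CycEdge : (Fin N → V) → V → V → Set
  CycEdge c x y = Σ[ i ∈ Fin N ] ((c i ≡ x × c (oneF i) ≡ y) ⊎ (c i ≡ y × c (oneF i) ≡ x))

  -- parts of a decomposition: just i = i-th Hamilton cycle, nothing = the
  -- perfect matching M (present only when hasM ≡ true)
  InPart : {m : ℕ} → (Fin m → HamCycle) → Bool → (V → V)
         → Maybe (Fin m) → V → V → Set
  InPart cs hasM M (just i) x y = CycEdge (HamCycle.cyc (cs i)) x y
  InPart cs hasM M nothing x y = hasM ≡ true × M x ≡ y

  -- Valency d = 2k: partition of the edges into k Hamilton cycles;
  -- valency d = 2k-1: k-1 Hamilton cycles and a perfect matching.
  record HamDecomposition (d : ℕ) : Set where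
    field
      m        : ℕ
      cycles   : Fin m → HamCycle
      hasM     : Bool
      M        : V → V
      M-inv    : hasM ≡ true → ∀ x → M (M x) ≡ x
      M-nofix  : hasM ≡ true → ∀ x → ¬ (M x ≡ x)
      M-adj    : hasM ≡ true → ∀ x → Adj x (M x)
      count-even : hasM ≡ false → d ≡ m + m
      count-odd  : hasM ≡ true → d ≡ suc (m + m)
      cover  : ∀ x y → Adj x y → Σ[ q ∈ Maybe (Fin m) ] InPart cycles hasM M q x y
      unique : ∀ x y → Adj x y → ∀ q r → InPart cycles hasM M q x y
             → InPart cycles hasM M r x y → q ≡ r

HasHamiltonDecomposition : ∀ {n} → (D n → Bool) → Set
HasHamiltonDecomposition {n} S = HamDecomposition (2 * n) (CayAdj S) (card S)

module Submission where

-- Write S = R ∪ {βα^k} with R ⊆ ⟨α⟩ ≅ ℤ_p symmetric and 0 ∉ R. Relabelling βα^(x+k) as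
-- (true , x) turns Cay(D_2p, S) into the prism over the circulant Circ(ℤ_p, R): two copies of
-- Circ(ℤ_p, R) joined by the rungs (false , x) — (true , x). For each pair ±a ⊆ R let c = a/2
-- (p is odd). The a-cycle runs c, c + a, …, c + (p-1)a = -c along the upper layer (a generates ℤ_p
-- since p is prime), takes the rung at -c, runs back -c, -c - a, …, c along the lower layer and
-- returns over the rung at c. It uses every layer edge of difference ±a except the two joining c
-- and -c, and the rungs at ±c. What no cycle uses is thus the layer edges {u, -u} with 2u ∈ R and
-- the rungs at the u with 2u ∉ R, which form a perfect matching.

open import Defs
open import Level using (0ℓ)
open import Function using (id; _∘_; Equivalence)
open import Algebra.Bundles using (AbelianGroup)
open import Algebra.Structures using (IsAbelianGroup)
open import Data.Bool using (Bool; true; false; not; _∧_; if_then_else_; T)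
open import Data.Bool.Properties using (not-involutive; not-¬; T-≡; T-∧; ∧-zeroʳ; ∧-identityʳ)
import Data.Bool as Bool
open import Data.Nat using (ℕ; zero; suc; pred; _+_; _*_; _∸_; _≤_; _<_; _≥_; _≤?_; s≤s; z≤n)
import Data.Nat.Properties as ℕ
open import Data.Nat.DivMod using (_%_; _mod_; %-distribˡ-+; m<n⇒m%n≡m; n%n≡0; m*n%n≡0)
open import Data.Nat.Divisibility using (_∣_; divides; >⇒∤; m%n≡0⇒n∣m)
open import Data.Nat.Primality using (Prime; euclidsLemma; prime⇒irreducible)
open import Data.Fin using (Fin; toℕ; fromℕ<; punchOut; _<?_) renaming (zero to fzero; suc to fsuc; _<_ to _<ᶠ_)
open import Data.Fin.Properties
  using (toℕ-injective; toℕ-fromℕ<; toℕ<n; <-cmp; <-asym; <-irrefl; any?; pigeonhole; punchOut-injective)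
import Data.Fin as Fin
open import Data.Fin.Permutation using (Permutation; permutation; _⟨$⟩ʳ_)
open import Data.List using (List; _∷_; length; lookup; filterᵇ; tabulate; map; allFin; _++_)
open import Data.List.Properties using (length-++; filter-++; map-tabulate)
open import Data.List.Relation.Unary.Unique.Propositional using (Unique)
open import Data.List.Relation.Unary.Unique.Propositional.Properties using (filter⁺; allFin⁺)
open import Data.List.Relation.Unary.AllPairs using (_∷_)
import Data.List.Relation.Unary.All as All
open import Data.List.Relation.Unary.Any using (index)
open import Data.List.Relation.Unary.Any.Properties using (lookup-index)
open import Data.List.Membership.Propositional using (_∈_)
open import Data.List.Membership.Propositional.Properties using (∈-lookup; ∈-filter⁺; ∈-filter⁻; ∈-allFin)
open import Data.Maybe using (Maybe; just; nothing)
open import Data.Product using (Σ; Σ-syntax; _,_; _×_; proj₁; proj₂)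
open import Data.Product.Properties using (≡-dec)
open import Data.Sum using (_⊎_; inj₁; inj₂)
open import Relation.Binary.Definitions using (tri<; tri≈; tri>)
open import Relation.Binary.PropositionalEquality
open import Relation.Binary.PropositionalEquality.Algebra using (isMagma)
open import Relation.Nullary using (¬_; contradiction; does; yes; no)
open import Relation.Nullary.Decidable using (T?; dec-true; dec-false)
open import Algebra.Properties.CommutativeMonoid.Sum ℕ.+-0-commutativeMonoid
  using (sum; sum-cong-≗; ∑-distrib-+; sum-permute; sum-replicate-zero)

module Cyclic (p : ℕ) where
  open ≡-Reasoning

  P : ℕ
  P = suc p

  Z : Set
  Z = Fin P

  infixl 6 _⊕_ _-_
  infix 8 ⊖_

  _⊕_ : Z → Z → Z
  _⊕_ = addF

  ⊖_ : Z → Z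
  ⊖_ = negF

  _-_ : Z → Z → Z
  x - y = x ⊕ ⊖ y

  𝟘 : Z
  𝟘 = zeroF

  ⟦_⟧ : ℕ → Z
  ⟦ m ⟧ = m mod P

  toℕ-⟦⟧ : ∀ m → toℕ ⟦ m ⟧ ≡ m % P
  toℕ-⟦⟧ m = toℕ-fromℕ< _

  ⟦⟧-cong-% : ∀ m n → m % P ≡ n % P → ⟦ m ⟧ ≡ ⟦ n ⟧
  ⟦⟧-cong-% m n eq = toℕ-injective (trans (toℕ-⟦⟧ m) (trans eq (sym (toℕ-⟦⟧ n))))

  ⟦toℕ⟧ : ∀ x → ⟦ toℕ x ⟧ ≡ x
  ⟦toℕ⟧ x = toℕ-injective (trans (toℕ-⟦⟧ (toℕ x)) (m<n⇒m%n≡m (toℕ<n x)))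

  ⟦⟧-homo-+ : ∀ m n → ⟦ m + n ⟧ ≡ ⟦ m ⟧ ⊕ ⟦ n ⟧
  ⟦⟧-homo-+ m n = ⟦⟧-cong-% (m + n) (toℕ ⟦ m ⟧ + toℕ ⟦ n ⟧) (trans (%-distribˡ-+ m n P)
    (sym (cong₂ (λ u v → (u + v) % P) (toℕ-⟦⟧ m) (toℕ-⟦⟧ n))))

  ⟦P⟧ : ⟦ P ⟧ ≡ 𝟘
  ⟦P⟧ = ⟦⟧-cong-% P 0 (n%n≡0 P)

  ⊕-comm : ∀ x y → x ⊕ y ≡ y ⊕ x
  ⊕-comm x y = cong ⟦_⟧ (ℕ.+-comm (toℕ x) (toℕ y))

  ⊕-assoc : ∀ x y z → (x ⊕ y) ⊕ z ≡ x ⊕ (y ⊕ z)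
  ⊕-assoc x y z = begin
    (x ⊕ y) ⊕ z                    ≡⟨ cong ((x ⊕ y) ⊕_) (⟦toℕ⟧ z) ⟨
    ⟦ toℕ x + toℕ y ⟧ ⊕ ⟦ toℕ z ⟧    ≡⟨ ⟦⟧-homo-+ (toℕ x + toℕ y) (toℕ z) ⟨
    ⟦ toℕ x + toℕ y + toℕ z ⟧        ≡⟨ cong ⟦_⟧ (ℕ.+-assoc (toℕ x) (toℕ y) (toℕ z)) ⟩
    ⟦ toℕ x + (toℕ y + toℕ z) ⟧      ≡⟨ ⟦⟧-homo-+ (toℕ x) (toℕ y + toℕ z) ⟩
    ⟦ toℕ x ⟧ ⊕ (y ⊕ z)              ≡⟨ cong (_⊕ (y ⊕ z)) (⟦toℕ⟧ x) ⟩
    x ⊕ (y ⊕ z)                    ∎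

  ⊕-identityˡ : ∀ x → 𝟘 ⊕ x ≡ x
  ⊕-identityˡ = ⟦toℕ⟧

  ⊕-identityʳ : ∀ x → x ⊕ 𝟘 ≡ x
  ⊕-identityʳ x = trans (⊕-comm x 𝟘) (⊕-identityˡ x)

  ⊕-inverseʳ : ∀ x → x ⊕ ⊖ x ≡ 𝟘
  ⊕-inverseʳ x = begin
    x ⊕ ⊖ x                    ≡⟨ cong (_⊕ ⊖ x) (⟦toℕ⟧ x) ⟨
    ⟦ toℕ x ⟧ ⊕ ⟦ P ∸ toℕ x ⟧    ≡⟨ ⟦⟧-homo-+ (toℕ x) (P ∸ toℕ x) ⟨
    ⟦ toℕ x + (P ∸ toℕ x) ⟧      ≡⟨ cong ⟦_⟧ (ℕ.m+[n∸m]≡n (ℕ.<⇒≤ (toℕ<n x))) ⟩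
    ⟦ P ⟧                        ≡⟨ ⟦P⟧ ⟩
    𝟘                            ∎

  ⊕-isAbelianGroup : IsAbelianGroup _≡_ _⊕_ 𝟘 ⊖_
  ⊕-isAbelianGroup = record
    { isGroup = record
      { isMonoid = record
        { isSemigroup = record { isMagma = isMagma _⊕_ ; assoc = ⊕-assoc }
        ; identity = ⊕-identityˡ , ⊕-identityʳ
        }
      ; inverse = (λ x → trans (⊕-comm (⊖ x) x) (⊕-inverseʳ x)) , ⊕-inverseʳ
      ; ⁻¹-cong = cong ⊖_
      }
    ; comm = ⊕-comm
    }

  ⊕-abelianGroup : AbelianGroup 0ℓ 0ℓ
  ⊕-abelianGroup = record { isAbelianGroup = ⊕-isAbelianGroup }

  open AbelianGroup ⊕-abelianGroup public using (commutativeMonoid)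
  open import Algebra.Properties.AbelianGroup ⊕-abelianGroup public
  open import Algebra.Properties.CommutativeMonoid.Mult commutativeMonoid public
    using (×-homo-+; ×-distrib-+) renaming (_×_ to _×ᶻ_)

  ⟦⟧-homo-* : ∀ n m → n ×ᶻ ⟦ m ⟧ ≡ ⟦ n * m ⟧
  ⟦⟧-homo-* zero m = refl
  ⟦⟧-homo-* (suc n) m = trans (cong (⟦ m ⟧ ⊕_) (⟦⟧-homo-* n m)) (sym (⟦⟧-homo-+ m (n * m)))

  ×ᶻ-toℕ : ∀ n x → n ×ᶻ x ≡ ⟦ n * toℕ x ⟧
  ×ᶻ-toℕ n x = trans (cong (n ×ᶻ_) (sym (⟦toℕ⟧ x))) (⟦⟧-homo-* n (toℕ x))

  P×ᶻ : ∀ x → P ×ᶻ x ≡ 𝟘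
  P×ᶻ x = trans (×ᶻ-toℕ P x)
    (⟦⟧-cong-% (P * toℕ x) 0 (trans (cong (_% P) (ℕ.*-comm P (toℕ x))) (m*n%n≡0 (toℕ x) P)))

  -≡⇒≡+ : ∀ x y d → y - x ≡ d → y ≡ x ⊕ d
  -≡⇒≡+ x y d y-x≡d = trans (sym (//-rightDividesˡ x y)) (trans (cong (_⊕ x) y-x≡d) (⊕-comm d x))

  [x⊕z]-[y⊕z]≡x-y : ∀ x y z → (x ⊕ z) - (y ⊕ z) ≡ x - y
  [x⊕z]-[y⊕z]≡x-y x y z = begin
    (x ⊕ z) ⊕ ⊖ (y ⊕ z)     ≡⟨ cong ((x ⊕ z) ⊕_) (⁻¹-anti-homo-∙ y z) ⟩
    (x ⊕ z) ⊕ (⊖ z ⊕ ⊖ y)   ≡⟨ ⊕-assoc (x ⊕ z) (⊖ z) (⊖ y) ⟨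
    (x ⊕ z) ⊕ ⊖ z ⊕ ⊖ y     ≡⟨ cong (_- y) (//-rightDividesʳ z x) ⟩
    x - y                   ∎

  sign : Bool → Z → Z
  sign false x = x
  sign true x = ⊖ x

  sign-involutive : ∀ s x → sign s (sign s x) ≡ x
  sign-involutive false x = refl
  sign-involutive true x = ⁻¹-involutive x

  sign-⊖ : ∀ s x → sign s (⊖ x) ≡ ⊖ sign s x
  sign-⊖ false x = refl
  sign-⊖ true x = refl

  sign-not : ∀ s x → sign (not s) x ≡ ⊖ sign s x
  sign-not false x = refl
  sign-not true x = sym (⁻¹-involutive x)

  sign-injective : ∀ s {x y} → sign s x ≡ sign s y → x ≡ y
  sign-injective s {x} {y} eq =
    trans (sym (sign-involutive s x)) (trans (cong (sign s) eq) (sign-involutive s y))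

  sign-homo : ∀ s x y → sign s (x ⊕ y) ≡ sign s x ⊕ sign s y
  sign-homo false x y = refl
  sign-homo true x y = sym (⁻¹-∙-comm x y)

  infix 4 _≈±_
  _≈±_ : Z → Z → Set
  x ≈± a = Σ Bool λ s → x ≡ sign s a

  ≈±-⊖ : ∀ {x a} → x ≈± a → ⊖ x ≈± a
  ≈±-⊖ {a = a} (s , x≡) = not s , trans (cong ⊖_ x≡) (sym (sign-not s a))

even-or-odd : ∀ n → (Σ ℕ λ h → n ≡ h + h) ⊎ (Σ ℕ λ h → n ≡ suc (h + h))
even-or-odd zero = inj₁ (0 , refl)
even-or-odd (suc n) with even-or-odd n
... | inj₁ (h , n≡2h) = inj₂ (h , cong suc n≡2h)
... | inj₂ (h , n≡1+2h) = inj₁ (suc h , cong suc (trans n≡1+2h (sym (ℕ.+-suc h h))))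

module CyclicPrime (p : ℕ) (P-prime : Prime (suc p)) (3≤P : suc p ≥ 3) where
  open Cyclic p
  open ≡-Reasoning

  p-even : Σ ℕ λ h → p ≡ h + h
  p-even with even-or-odd p
  ... | inj₁ even = even
  ... | inj₂ (h , p≡1+2h) with prime⇒irreducible P-prime {2} (divides (suc h) 2[1+h]≡P)
    where
      2[1+h]≡P : P ≡ suc h * 2
      2[1+h]≡P = begin
        P                   ≡⟨ cong suc p≡1+2h ⟩
        suc (suc (h + h))   ≡⟨ cong suc (ℕ.+-suc h h) ⟨
        suc h + suc h       ≡⟨ cong (suc h +_) (ℕ.+-identityʳ (suc h)) ⟨
        2 * suc h           ≡⟨ ℕ.*-comm 2 (suc h) ⟩
        suc h * 2           ∎
  ... | inj₁ ()
  ... | inj₂ 2≡P = contradiction (subst (3 ≤_) (sym 2≡P) 3≤P) (ℕ.<⇒≱ (s≤s (s≤s (s≤s z≤n))))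

  -- With P = 2h + 1, (h + 1)·x is half of x since 2(h + 1) ≡ 1 mod P.
  half : Z → Z
  half x = suc (proj₁ p-even) ×ᶻ x

  half-+ : ∀ x → half x ⊕ half x ≡ x
  half-+ x = begin
    half x ⊕ half x        ≡⟨ ×-homo-+ x (suc h) (suc h) ⟨
    (suc h + suc h) ×ᶻ x   ≡⟨ cong (_×ᶻ x) 1+h+1+h≡1+P ⟩
    x ⊕ P ×ᶻ x             ≡⟨ cong (x ⊕_) (P×ᶻ x) ⟩
    x ⊕ 𝟘                  ≡⟨ ⊕-identityʳ x ⟩
    x                      ∎
    where
      h : ℕ
      h = proj₁ p-even
      1+h+1+h≡1+P : suc h + suc h ≡ suc P
      1+h+1+h≡1+P = cong suc (trans (ℕ.+-suc h h) (cong suc (sym (proj₂ p-even))))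

  half-unique : ∀ u x → u ⊕ u ≡ x → u ≡ half x
  half-unique u x u+u≡x = begin
    u                         ≡⟨ half-+ u ⟨
    half u ⊕ half u           ≡⟨ ×-distrib-+ u u (suc (proj₁ p-even)) ⟨
    half (u ⊕ u)              ≡⟨ cong half u+u≡x ⟩
    half x                    ∎

  double-injective : ∀ x y → x ⊕ x ≡ y ⊕ y → x ≡ y
  double-injective x y eq = trans (half-unique x (y ⊕ y) eq) (sym (half-unique y (y ⊕ y) refl))

  ∣∧<⇒≡0 : ∀ n → P ∣ n → n < P → n ≡ 0
  ∣∧<⇒≡0 zero _ _ = refl
  ∣∧<⇒≡0 (suc n) P∣n n<P = contradiction P∣n (>⇒∤ n<P)

  ×ᶻ-≡𝟘⇒≡0 : ∀ {a} d → ¬ a ≡ 𝟘 → d < P → d ×ᶻ a ≡ 𝟘 → d ≡ 0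
  ×ᶻ-≡𝟘⇒≡0 {a} d a≢𝟘 d<P da≡𝟘 with euclidsLemma d (toℕ a) P-prime P∣da
    where
      P∣da : P ∣ d * toℕ a
      P∣da = m%n≡0⇒n∣m (d * toℕ a) P (trans (sym (toℕ-⟦⟧ (d * toℕ a)))
                                       (cong toℕ (trans (sym (×ᶻ-toℕ d a)) da≡𝟘)))
  ... | inj₁ P∣d = ∣∧<⇒≡0 d P∣d d<P
  ... | inj₂ P∣a = contradiction (toℕ-injective (∣∧<⇒≡0 (toℕ a) P∣a (toℕ<n a))) a≢𝟘

  ×ᶻ-cancelʳ-≤ : ∀ {a} m n → ¬ a ≡ 𝟘 → m < P → n ≤ m → m ×ᶻ a ≡ n ×ᶻ a → m ≡ n
  ×ᶻ-cancelʳ-≤ {a} m n a≢𝟘 m<P n≤m ma≡na = ℕ.≤-antisym (ℕ.m∸n≡0⇒m≤n m∸n≡0) n≤m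
    where
      [m∸n]a≡𝟘 : (m ∸ n) ×ᶻ a ≡ 𝟘
      [m∸n]a≡𝟘 = identityˡ-unique ((m ∸ n) ×ᶻ a) (n ×ᶻ a) (begin
        (m ∸ n) ×ᶻ a ⊕ n ×ᶻ a   ≡⟨ ×-homo-+ a (m ∸ n) n ⟨
        (m ∸ n + n) ×ᶻ a        ≡⟨ cong (_×ᶻ a) (ℕ.m∸n+n≡m n≤m) ⟩
        m ×ᶻ a                  ≡⟨ ma≡na ⟩
        n ×ᶻ a                  ∎)
      m∸n≡0 : m ∸ n ≡ 0
      m∸n≡0 = ×ᶻ-≡𝟘⇒≡0 (m ∸ n) a≢𝟘 (ℕ.≤-<-trans (ℕ.m∸n≤m m n) m<P) [m∸n]a≡𝟘

  ×ᶻ-cancelʳ : ∀ {a} m n → ¬ a ≡ 𝟘 → m < P → n < P → m ×ᶻ a ≡ n ×ᶻ a → m ≡ n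
  ×ᶻ-cancelʳ m n a≢𝟘 m<P n<P eq with ℕ.≤-total n m
  ... | inj₁ n≤m = ×ᶻ-cancelʳ-≤ m n a≢𝟘 m<P n≤m eq
  ... | inj₂ m≤n = sym (×ᶻ-cancelʳ-≤ n m a≢𝟘 n<P m≤n (sym eq))

  ⊖-fixed⇒𝟘 : ∀ x → x ≡ ⊖ x → x ≡ 𝟘
  ⊖-fixed⇒𝟘 x x≡⊖x =
    double-injective x 𝟘 (trans (cong (x ⊕_) x≡⊖x) (trans (⊕-inverseʳ x) (sym (⊕-identityˡ 𝟘))))

χ : Bool → ℕ
χ true = 1
χ false = 0

count : ∀ {n} → (Fin n → Bool) → ℕ
count g = sum (χ ∘ g)

count-cong : ∀ {n} {g g′ : Fin n → Bool} → (∀ i → g i ≡ g′ i) → count g ≡ count g′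
count-cong g≗g′ = sum-cong-≗ (cong χ ∘ g≗g′)

count-false : ∀ n → count {n} (λ _ → false) ≡ 0
count-false n = sum-replicate-zero n

count-permute : ∀ {n} (g : Fin n → Bool) (π : Permutation n n) → count g ≡ count (g ∘ (π ⟨$⟩ʳ_))
count-permute g π = sum-permute (χ ∘ g) π

count-split : ∀ {n} (g b : Fin n → Bool) →
              count g ≡ count (λ i → g i ∧ b i) + count (λ i → g i ∧ not (b i))
count-split g b = trans (sum-cong-≗ (λ i → χ-split (g i) (b i)))
                        (∑-distrib-+ (λ i → χ (g i ∧ b i)) (λ i → χ (g i ∧ not (b i))))
  where
    χ-split : ∀ x y → χ x ≡ χ (x ∧ y) + χ (x ∧ not y)
    χ-split false y = refl
    χ-split true false = refl
    χ-split true true = refl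

count-≡0 : ∀ {n} (g : Fin n → Bool) → count g ≡ 0 → ∀ i → g i ≡ false
count-≡0 g eq fzero with g fzero
... | false = refl
count-≡0 g eq (fsuc i) with g fzero
... | false = count-≡0 (g ∘ fsuc) eq i

count-≡1 : ∀ {n} (g : Fin n → Bool) → count g ≡ 1 →
           Σ (Fin n) λ k → g k ≡ true × (∀ i → g i ≡ true → i ≡ k)
count-≡1 {suc n} g eq with g fzero in g0
... | true = fzero , g0 , λ
  { fzero _ → refl
  ; (fsuc i) gi → contradiction (trans (sym gi) (count-≡0 (g ∘ fsuc) (cong pred eq) i)) λ () }
... | false with count-≡1 (g ∘ fsuc) eq
... | k , gk , k-unique = fsuc k , gk , λ
  { fzero g0′ → contradiction (trans (sym g0) g0′) λ ()
  ; (fsuc i) gi → cong fsuc (k-unique i gi) }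

length-filterᵇ-tabulate : ∀ {A : Set} {n} (g : A → Bool) (f : Fin n → A) →
                          length (filterᵇ g (tabulate f)) ≡ count (g ∘ f)
length-filterᵇ-tabulate {n = zero} g f = refl
length-filterᵇ-tabulate {n = suc n} g f with g (f fzero)
... | true = cong suc (length-filterᵇ-tabulate g (f ∘ fsuc))
... | false = length-filterᵇ-tabulate g (f ∘ fsuc)

card-split : ∀ {n} (T : D n → Bool) → card T ≡ count (T ∘ (false ,_)) + count (T ∘ (true ,_))
card-split {n} T = begin
  card T
    ≡⟨ cong length (filter-++ (T? ∘ T) (map (false ,_) (allFin n)) (map (true ,_) (allFin n))) ⟩
  length (filterᵇ T (map (false ,_) (allFin n)) ++ filterᵇ T (map (true ,_) (allFin n)))
    ≡⟨ length-++ (filterᵇ T (map (false ,_) (allFin n))) ⟩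
  length (filterᵇ T (map (false ,_) (allFin n))) + length (filterᵇ T (map (true ,_) (allFin n)))
    ≡⟨ cong₂ (λ xs ys → length (filterᵇ T xs) + length (filterᵇ T ys))
             (map-tabulate (λ i → i) (false ,_)) (map-tabulate (λ i → i) (true ,_)) ⟩
  length (filterᵇ T (tabulate (false ,_))) + length (filterᵇ T (tabulate (true ,_)))
    ≡⟨ cong₂ _+_ (length-filterᵇ-tabulate T (false ,_)) (length-filterᵇ-tabulate T (true ,_)) ⟩
  count (T ∘ (false ,_)) + count (T ∘ (true ,_)) ∎
  where open ≡-Reasoning

lookup-injective : ∀ {A : Set} {xs : List A} → Unique xs → ∀ i j → lookup xs i ≡ lookup xs j → i ≡ j
lookup-injective {xs = x ∷ xs} u fzero fzero eq = refl
lookup-injective {xs = x ∷ xs} (x∉xs ∷ u) fzero (fsuc j) eq =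
  contradiction eq (All.lookup x∉xs (∈-lookup j))
lookup-injective {xs = x ∷ xs} (x∉xs ∷ u) (fsuc i) fzero eq =
  contradiction (sym eq) (All.lookup x∉xs (∈-lookup i))
lookup-injective {xs = x ∷ xs} (x∉xs ∷ u) (fsuc i) (fsuc j) eq = cong fsuc (lookup-injective u i j eq)

-- A map missing y factors through Fin n via punchOut, so the pigeonhole principle applies.
injective⇒surjective : ∀ {n} (g : Fin n → Fin n) → (∀ i j → g i ≡ g j → i ≡ j) →
                       ∀ y → Σ (Fin n) λ i → g i ≡ y
injective⇒surjective {suc n} g g-injective y with any? (λ i → g i Fin.≟ y)
... | yes hit = hit
... | no miss =
  let y≢g : ∀ i → y ≢ g i
      y≢g i y≡gi = miss (i , sym y≡gi)
      i , j , i<j , eq = pigeonhole (ℕ.n<1+n n) (λ i → punchOut (y≢g i))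
  in contradiction (g-injective i j (punchOut-injective (y≢g i) (y≢g j) eq)) (λ i≡j → <-irrefl i≡j i<j)

module Transport {V W : Set} (N : ℕ) (E : V → V → Set) (F : W → W → Set)
  (φ : V → W) (ψ : W → V) (ψ∘φ : ∀ x → ψ (φ x) ≡ x) (φ∘ψ : ∀ y → φ (ψ y) ≡ y)
  (E⇒F : ∀ {x y} → E x y → F (φ x) (φ y)) (F⇒E : ∀ {x y} → F (φ x) (φ y) → E x y) where

  private
    to : ∀ {v y} → v ≡ ψ y → φ v ≡ y
    to {y = y} eq = trans (cong φ eq) (φ∘ψ y)

    from : ∀ {v y} → φ v ≡ y → v ≡ ψ y
    from {v} eq = trans (sym (ψ∘φ v)) (cong ψ eq)

  mapCycle : HamCycle N E → HamCycle N F
  mapCycle C = record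
    { cyc = φ ∘ cyc
    ; inj = λ a b eq → inj a b (trans (from eq) (ψ∘φ _))
    ; adj = E⇒F ∘ adj
    }
    where open HamCycle C

  mapCycEdge : ∀ {c x y} → CycEdge N E c (ψ x) (ψ y) → CycEdge N F (φ ∘ c) x y
  mapCycEdge (i , inj₁ (e₁ , e₂)) = i , inj₁ (to e₁ , to e₂)
  mapCycEdge (i , inj₂ (e₁ , e₂)) = i , inj₂ (to e₁ , to e₂)

  unmapCycEdge : ∀ {c x y} → CycEdge N F (φ ∘ c) x y → CycEdge N E c (ψ x) (ψ y)
  unmapCycEdge (i , inj₁ (e₁ , e₂)) = i , inj₁ (from e₁ , from e₂)
  unmapCycEdge (i , inj₂ (e₁ , e₂)) = i , inj₂ (from e₁ , from e₂)

  transport : ∀ {d} → HamDecomposition N E d → HamDecomposition N F d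
  transport H = record
    { m = m
    ; cycles = cycles′
    ; hasM = hasM
    ; M = M′
    ; M-inv = λ h y → trans (cong (φ ∘ M) (ψ∘φ _)) (to (M-inv h (ψ y)))
    ; M-nofix = λ h y eq → M-nofix h (ψ y) (from eq)
    ; M-adj = λ h y → subst (λ z → F z (M′ y)) (φ∘ψ y) (E⇒F (M-adj h (ψ y)))
    ; count-even = count-even
    ; count-odd = count-odd
    ; cover = λ x y xFy → let q , part = cover (ψ x) (ψ y) (F⇒E′ xFy) in q , mapPart q part
    ; unique = λ x y xFy q r pq pr →
        unique (ψ x) (ψ y) (F⇒E′ xFy) q r (unmapPart q pq) (unmapPart r pr)
    }
    where
      open HamDecomposition H
      cycles′ : Fin m → HamCycle N F
      cycles′ = mapCycle ∘ cycles

      M′ : W → W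
      M′ = φ ∘ M ∘ ψ

      F⇒E′ : ∀ {x y} → F x y → E (ψ x) (ψ y)
      F⇒E′ {x} {y} = F⇒E ∘ subst₂ F (sym (φ∘ψ x)) (sym (φ∘ψ y))

      mapPart : ∀ {x y} q → InPart N E cycles hasM M q (ψ x) (ψ y) → InPart N F cycles′ hasM M′ q x y
      mapPart (just i) e = mapCycEdge e
      mapPart nothing (h , e) = h , to e

      unmapPart : ∀ {x y} q → InPart N F cycles′ hasM M′ q x y → InPart N E cycles hasM M q (ψ x) (ψ y)
      unmapPart (just i) e = unmapCycEdge e
      unmapPart nothing (h , e) = h , from e

module Representatives (p : ℕ) (P-prime : Prime (suc p)) (3≤P : suc p ≥ 3)
             (R : Fin (suc p) → Bool) (R-⊖ : ∀ x → R (negF x) ≡ R x) (R-𝟘 : R zeroF ≡ false) where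
  open Cyclic p
  open CyclicPrime p P-prime 3≤P
  open ≡-Reasoning

  R-sign : ∀ s x → R (sign s x) ≡ R x
  R-sign false x = refl
  R-sign true x = R-⊖ x

  R⇒≢𝟘 : ∀ x → R x ≡ true → ¬ x ≡ 𝟘
  R⇒≢𝟘 x Rx refl = contradiction (trans (sym R-𝟘) Rx) λ ()

  isRep : Z → Bool
  isRep x = does (x <? ⊖ x)

  isRep-⊖ : ∀ x → ¬ x ≡ 𝟘 → isRep (⊖ x) ≡ not (isRep x)
  isRep-⊖ x x≢𝟘 with <-cmp x (⊖ x)
  ... | tri< x<⊖x _ _ = trans ⊖x≮x (cong not (sym (dec-true (x <? ⊖ x) x<⊖x)))
    where
      ⊖x≮x : isRep (⊖ x) ≡ false
      ⊖x≮x = dec-false (⊖ x <? ⊖ (⊖ x))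
               (λ lt → <-asym x<⊖x (subst (⊖ x <ᶠ_) (⁻¹-involutive x) lt))
  ... | tri≈ _ x≡⊖x _ = contradiction (⊖-fixed⇒𝟘 x x≡⊖x) x≢𝟘
  ... | tri> _ _ ⊖x<x = trans ⊖x<⊖⊖x (cong not (sym (dec-false (x <? ⊖ x) (<-asym ⊖x<x))))
    where
      ⊖x<⊖⊖x : isRep (⊖ x) ≡ true
      ⊖x<⊖⊖x = dec-true (⊖ x <? ⊖ (⊖ x)) (subst (⊖ x <ᶠ_) (sym (⁻¹-involutive x)) ⊖x<x)

  R⁺ : Z → Bool
  R⁺ x = R x ∧ isRep x

  reps : List Z
  reps = filterᵇ R⁺ (allFin P)

  m : ℕ
  m = length reps

  A : Fin m → Z
  A = lookup reps

  A-R⁺ : ∀ q → T (R (A q)) × T (isRep (A q))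
  A-R⁺ q = Equivalence.to T-∧ (proj₂ (∈-filter⁻ (T? ∘ R⁺) {xs = allFin P} (∈-lookup q)))

  A-R : ∀ q → R (A q) ≡ true
  A-R q = Equivalence.to T-≡ (proj₁ (A-R⁺ q))

  A-isRep : ∀ q → isRep (A q) ≡ true
  A-isRep q = Equivalence.to T-≡ (proj₂ (A-R⁺ q))

  A-injective : ∀ q r → A q ≡ A r → q ≡ r
  A-injective = lookup-injective (filter⁺ (T? ∘ R⁺) (allFin⁺ P))

  A-surjective : ∀ x → R⁺ x ≡ true → Σ (Fin m) λ q → A q ≡ x
  A-surjective x R⁺x = index x∈reps , sym (lookup-index x∈reps)
    where
      x∈reps : x ∈ reps
      x∈reps = ∈-filter⁺ (T? ∘ R⁺) (∈-allFin x) (Equivalence.from T-≡ R⁺x)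

  classify : ∀ x → R x ≡ true → Σ (Fin m) λ q → x ≈± A q
  classify x Rx with isRep x in rep
  ... | true = let q , Aq≡x = A-surjective x (cong₂ _∧_ Rx rep) in q , false , sym Aq≡x
  ... | false =
    let q , Aq≡⊖x = A-surjective (⊖ x) R⁺⊖x
    in q , true , trans (sym (⁻¹-involutive x)) (cong ⊖_ (sym Aq≡⊖x))
    where
      R⁺⊖x : R⁺ (⊖ x) ≡ true
      R⁺⊖x = cong₂ _∧_ (trans (R-⊖ x) Rx) (trans (isRep-⊖ x (R⇒≢𝟘 x Rx)) (cong not rep))

  reps-not-opposite : ∀ q r → ¬ A q ≡ ⊖ A r
  reps-not-opposite q r Aq≡⊖Ar = contradiction (begin
    true               ≡⟨ A-isRep q ⟨
    isRep (A q)        ≡⟨ cong isRep Aq≡⊖Ar ⟩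
    isRep (⊖ A r)      ≡⟨ isRep-⊖ (A r) (R⇒≢𝟘 (A r) (A-R r)) ⟩
    not (isRep (A r))  ≡⟨ cong not (A-isRep r) ⟩
    false              ∎) λ ()

  classify-unique : ∀ {x} q r → x ≈± A q → x ≈± A r → q ≡ r
  classify-unique q r (false , x≡Aq) (false , x≡Ar) = A-injective q r (trans (sym x≡Aq) x≡Ar)
  classify-unique q r (true , x≡⊖Aq) (true , x≡⊖Ar) =
    A-injective q r (⁻¹-injective (trans (sym x≡⊖Aq) x≡⊖Ar))
  classify-unique q r (false , x≡Aq) (true , x≡⊖Ar) =
    contradiction (trans (sym x≡Aq) x≡⊖Ar) (reps-not-opposite q r)
  classify-unique q r (true , x≡⊖Aq) (false , x≡Ar) =
    contradiction (trans (sym x≡Ar) x≡⊖Aq) (reps-not-opposite r q)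

  count-R : count R ≡ m + m
  count-R = begin
    count R
      ≡⟨ count-split R isRep ⟩
    count R⁺ + count (λ x → R x ∧ not (isRep x))
      ≡⟨ cong (count R⁺ +_) (count-cong R∧¬isRep≡R⁺∘⊖) ⟩
    count R⁺ + count (R⁺ ∘ ⊖_)
      ≡⟨ cong (count R⁺ +_) (count-permute R⁺ ⊖-permutation) ⟨
    count R⁺ + count R⁺
      ≡⟨ cong (λ n → n + n) (length-filterᵇ-tabulate R⁺ id) ⟨
    m + m ∎
    where
      ⊖-permutation : Permutation P P
      ⊖-permutation = permutation ⊖_ ⊖_ ⁻¹-involutive ⁻¹-involutive
      R∧¬isRep≡R⁺∘⊖ : ∀ x → R x ∧ not (isRep x) ≡ R⁺ (⊖ x)
      R∧¬isRep≡R⁺∘⊖ x with R x in Rx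
      ... | false = sym (cong (_∧ isRep (⊖ x)) (trans (R-⊖ x) Rx))
      ... | true = sym (cong₂ _∧_ (trans (R-⊖ x) Rx) (isRep-⊖ x (R⇒≢𝟘 x Rx)))

module CirculantPrism (p : ℕ) (P-prime : Prime (suc p)) (3≤P : suc p ≥ 3)
             (R : Fin (suc p) → Bool) (R-⊖ : ∀ x → R (negF x) ≡ R x) (R-𝟘 : R zeroF ≡ false) where
  open Cyclic p
  open CyclicPrime p P-prime 3≤P
  open Representatives p P-prime 3≤P R R-⊖ R-𝟘 public
  open ≡-Reasoning

  V : Set
  V = Bool × Z

  -- The a-cycle consists of the edges labelled ±a other than the layer edges joining ±c. Lower
  -- differences are read in the opposite direction, as in Cay(D_2p, S); the rung at u is labelled 2u.
  label : V → V → Z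
  label (false , u) (false , w) = w - u
  label (true , u) (true , w) = u - w
  label (false , u) (true , w) = u ⊕ w
  label (true , u) (false , w) = u ⊕ w

  Prism : V → V → Set
  Prism (false , u) (false , w) = R (w - u) ≡ true
  Prism (true , u) (true , w) = R (u - w) ≡ true
  Prism (false , u) (true , w) = u ≡ w
  Prism (true , u) (false , w) = u ≡ w

  R-double-⊖ : ∀ u → R (⊖ u ⊕ ⊖ u) ≡ R (u ⊕ u)
  R-double-⊖ u = trans (cong R (⁻¹-∙-comm u u)) (R-⊖ (u ⊕ u))

  M : V → V
  M (s , u) = if R (u ⊕ u) then (s , ⊖ u) else (not s , u)

  M-layer : ∀ {s u} → R (u ⊕ u) ≡ true → M (s , u) ≡ (s , ⊖ u)
  M-layer eq rewrite eq = refl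

  M-rung : ∀ {s u} → R (u ⊕ u) ≡ false → M (s , u) ≡ (not s , u)
  M-rung eq rewrite eq = refl

  M-involutive : ∀ x → M (M x) ≡ x
  M-involutive (s , u) with R (u ⊕ u) in eq
  ... | true = trans (M-layer (trans (R-double-⊖ u) eq)) (cong (s ,_) (⁻¹-involutive u))
  ... | false = trans (M-rung eq) (cong (_, u) (not-involutive s))

  M-nofix : ∀ x → ¬ M x ≡ x
  M-nofix (s , u) with R (u ⊕ u) in eq
  ... | true = λ M≡ → contradiction (trans (sym R-𝟘) (trans (cong R (sym (2u≡𝟘 M≡))) eq)) λ ()
    where
      2u≡𝟘 : (s , ⊖ u) ≡ (s , u) → u ⊕ u ≡ 𝟘
      2u≡𝟘 M≡ = trans (cong (u ⊕_) (sym (cong proj₂ M≡))) (⊕-inverseʳ u)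
  ... | false = λ M≡ → not-¬ refl (sym (cong proj₁ M≡))

  M-adj : ∀ x → Prism x (M x)
  M-adj (s , u) with R (u ⊕ u) in eq
  M-adj (false , u) | true = trans (R-double-⊖ u) eq
  M-adj (true , u) | true = trans (cong (λ z → R (u ⊕ z)) (⁻¹-involutive u)) eq
  M-adj (false , u) | false = refl
  M-adj (true , u) | false = refl

  M-same-side : ∀ {s u w} → M (s , u) ≡ (s , w) → w ≡ ⊖ u
  M-same-side {s} {u} eq with R (u ⊕ u)
  ... | true = sym (cong proj₂ eq)
  ... | false = contradiction (cong proj₁ eq) (not-¬ refl ∘ sym)

  M-other-side : ∀ {s u w} → M (s , u) ≡ (not s , w) → R (u ⊕ u) ≡ false
  M-other-side {s} {u} eq with R (u ⊕ u)
  ... | true = contradiction (cong proj₁ eq) (not-¬ refl)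
  ... | false = refl

  ¬M-sym : ∀ {x y} → ¬ M x ≡ y → ¬ M y ≡ x
  ¬M-sym {x} {y} Mx≢y My≡x = Mx≢y (trans (cong M (sym My≡x)) (M-involutive y))

  label-swap : ∀ {a} x y → label x y ≈± a → label y x ≈± a
  label-swap (false , u) (false , w) = subst (_≈± _) (⁻¹-anti-homo‿- w u) ∘ ≈±-⊖
  label-swap (true , u) (true , w) = subst (_≈± _) (⁻¹-anti-homo‿- u w) ∘ ≈±-⊖
  label-swap (false , u) (true , w) = subst (_≈± _) (⊕-comm u w)
  label-swap (true , u) (false , w) = subst (_≈± _) (⊕-comm u w)

  label-layer : ∀ s u w → label (s , u) (s , w) ≡ sign s w - sign s u
  label-layer false u w = refl
  label-layer true u w = trans (⊕-comm u (⊖ w)) (cong (⊖ w ⊕_) (sym (⁻¹-involutive u)))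

  module Cycle (a : Z) (Ra : R a ≡ true) where

    c : Z
    c = half a

    f : ℕ → Z
    f n = c ⊕ n ×ᶻ a

    f-0 : f 0 ≡ c
    f-0 = ⊕-identityʳ c

    f-suc : ∀ n → f (suc n) ≡ f n ⊕ a
    f-suc n = trans (cong (c ⊕_) (⊕-comm a (n ×ᶻ a))) (sym (⊕-assoc c (n ×ᶻ a) a))

    f-P+ : ∀ n → f (P + n) ≡ f n
    f-P+ n = cong (c ⊕_) (begin
      (P + n) ×ᶻ a          ≡⟨ ×-homo-+ a P n ⟩
      P ×ᶻ a ⊕ n ×ᶻ a       ≡⟨ cong (_⊕ n ×ᶻ a) (P×ᶻ a) ⟩
      𝟘 ⊕ n ×ᶻ a            ≡⟨ ⊕-identityˡ (n ×ᶻ a) ⟩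
      n ×ᶻ a                ∎)

    f-P : f P ≡ c
    f-P = trans (cong f (sym (ℕ.+-identityʳ P))) (trans (f-P+ 0) f-0)

    f-p : f p ≡ ⊖ c
    f-p = inverseˡ-unique (f p) c (∙-cancelʳ c (f p ⊕ c) 𝟘 (begin
      f p ⊕ c ⊕ c         ≡⟨ ⊕-assoc (f p) c c ⟩
      f p ⊕ (c ⊕ c)       ≡⟨ cong (f p ⊕_) (half-+ a) ⟩
      f p ⊕ a             ≡⟨ f-suc p ⟨
      f P                 ≡⟨ f-P ⟩
      c                   ≡⟨ ⊕-identityˡ c ⟨
      𝟘 ⊕ c               ∎))

    ⊖c⊕⊖c : ⊖ c ⊕ ⊖ c ≡ ⊖ a
    ⊖c⊕⊖c = trans (⁻¹-∙-comm c c) (cong ⊖_ (half-+ a))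

    f-injective : ∀ {m n} → m < P → n < P → f m ≡ f n → m ≡ n
    f-injective {m} {n} m<P n<P fm≡fn =
      ×ᶻ-cancelʳ m n (R⇒≢𝟘 a Ra) m<P n<P (∙-cancelˡ c (m ×ᶻ a) (n ×ᶻ a) fm≡fn)

    f-surjective : ∀ x → Σ[ n ∈ ℕ ] n < P × f n ≡ x
    f-surjective x =
      let i , fi≡x = injective⇒surjective (f ∘ toℕ)
                       (λ i j eq → toℕ-injective (f-injective (toℕ<n i) (toℕ<n j) eq)) x
      in toℕ i , toℕ<n i , fi≡x

    vertex : Bool → ℕ → V
    vertex s n = s , sign s (f n)

    vertex-injective : ∀ {s s′ j j′} → j < P → j′ < P →
                       vertex s j ≡ vertex s′ j′ → s ≡ s′ × j ≡ j′
    vertex-injective {s} j<P j′<P eq with cong proj₁ eq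
    ... | refl = refl , f-injective j<P j′<P (sign-injective s (cong proj₂ eq))

    offset : Bool → ℕ
    offset false = 0
    offset true = P

    -- Position j < P of the cycle is (false , f j) and position P + j is (true , -f j), as f (P + j) = f j.
    vertexAt : ℕ → V
    vertexAt n = vertex (does (P ≤? n)) n

    vertexAt-offset : ∀ s j → j < P → vertexAt (offset s + j) ≡ vertex s j
    vertexAt-offset false j j<P = cong (λ s → vertex s j) (dec-false (P ≤? j) (ℕ.<⇒≱ j<P))
    vertexAt-offset true j j<P = trans (cong (λ s → vertex s (P + j)) (dec-true (P ≤? P + j) (ℕ.m≤m+n P j)))
                                       (cong (λ x → true , ⊖ x) (f-P+ j))

    2P≡P+P : 2 * P ≡ P + P
    2P≡P+P = cong (P +_) (ℕ.+-identityʳ P)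

    offset+<2P : ∀ s {j} → j < P → offset s + j < 2 * P
    offset+<2P false j<P = ℕ.<-≤-trans j<P (ℕ.m≤m+n P (P + 0))
    offset+<2P true j<P = ℕ.+-monoʳ-< P (ℕ.<-≤-trans j<P (ℕ.m≤m+n P 0))

    position : ∀ n → n < 2 * P → Σ[ s ∈ Bool ] Σ[ j ∈ ℕ ] j < P × offset s + j ≡ n
    position n n<2P with P ≤? n
    ... | no P≰n = false , n , ℕ.≰⇒> P≰n , refl
    ... | yes P≤n = true , n ∸ P , n∸P<P , ℕ.m+[n∸m]≡n P≤n
      where
        n∸P<P : n ∸ P < P
        n∸P<P = ℕ.+-cancelˡ-< P (n ∸ P) P
                  (subst (_< P + P) (sym (ℕ.m+[n∸m]≡n P≤n)) (subst (n <_) 2P≡P+P n<2P))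

    next : ℕ → ℕ
    next n = suc n % (2 * P)

    vertexAt-next-inner : ∀ s {j} → j < p → vertexAt (next (offset s + j)) ≡ vertex s (suc j)
    vertexAt-next-inner s {j} j<p = trans (cong vertexAt next≡) (vertexAt-offset s (suc j) (s≤s j<p))
      where
        next≡ : next (offset s + j) ≡ offset s + suc j
        next≡ = trans (cong (_% (2 * P)) (sym (ℕ.+-suc (offset s) j))) (m<n⇒m%n≡m (offset+<2P s (s≤s j<p)))

    vertexAt-next-last : ∀ s → vertexAt (next (offset s + p)) ≡ vertex (not s) 0
    vertexAt-next-last s = trans (cong vertexAt (next≡ s)) (vertexAt-offset (not s) 0 (s≤s z≤n))
      where
        next≡ : ∀ s → next (offset s + p) ≡ offset (not s) + 0
        next≡ false = trans (m<n⇒m%n≡m (ℕ.m<m+n P (s≤s z≤n))) (sym (ℕ.+-identityʳ P))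
        next≡ true = trans (cong (_% (2 * P)) (trans (sym (ℕ.+-suc P p)) (sym 2P≡P+P))) (n%n≡0 (2 * P))

    data Step : V → V → Set where
      layer : ∀ s j → j < p → Step (vertex s j) (vertex s (suc j))
      rung  : ∀ s → Step (vertex s p) (vertex (not s) 0)

    step-at : ∀ s j → j < P → Step (vertexAt (offset s + j)) (vertexAt (next (offset s + j)))
    step-at s j j<P with ℕ.m≤n⇒m<n∨m≡n (ℕ.≤-pred j<P)
    ... | inj₁ j<p = subst₂ Step (sym (vertexAt-offset s j j<P)) (sym (vertexAt-next-inner s j<p)) (layer s j j<p)
    ... | inj₂ refl = subst₂ Step (sym (vertexAt-offset s p j<P)) (sym (vertexAt-next-last s)) (rung s)

    cyc : Fin (2 * P) → V
    cyc t = vertexAt (toℕ t)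

    cyc-injective : ∀ t u → cyc t ≡ cyc u → t ≡ u
    cyc-injective t u eq =
      let s , j , j<P , t≡ = position (toℕ t) (toℕ<n t)
          s′ , j′ , j′<P , u≡ = position (toℕ u) (toℕ<n u)
          s≡s′ , j≡j′ = vertex-injective j<P j′<P (begin
            vertex s j               ≡⟨ vertexAt-offset s j j<P ⟨
            vertexAt (offset s + j)  ≡⟨ cong vertexAt t≡ ⟩
            cyc t                    ≡⟨ eq ⟩
            cyc u                    ≡⟨ cong vertexAt u≡ ⟨
            vertexAt (offset s′ + j′) ≡⟨ vertexAt-offset s′ j′ j′<P ⟩
            vertex s′ j′             ∎)
      in toℕ-injective (trans (sym t≡) (trans (cong₂ (λ s j → offset s + j) s≡s′ j≡j′) u≡))

    cyc-step : ∀ t → Step (cyc t) (cyc (oneF t))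
    cyc-step t =
      let s , j , j<P , t≡ = position (toℕ t) (toℕ<n t)
      in subst₂ Step (cong vertexAt t≡) (cong vertexAt (trans (cong next t≡) (sym (toℕ-fromℕ< _))))
                (step-at s j j<P)

    edge-at : ∀ n → n < 2 * P → ∀ {x y} → vertexAt n ≡ x → vertexAt (next n) ≡ y →
              Σ[ t ∈ Fin (2 * P) ] cyc t ≡ x × cyc (oneF t) ≡ y
    edge-at n n<2P e₁ e₂ = fromℕ< n<2P , trans (cong vertexAt (toℕ-fromℕ< n<2P)) e₁
                         , trans (cong vertexAt (trans (toℕ-fromℕ< _) (cong next (toℕ-fromℕ< n<2P)))) e₂

    step-position : ∀ {x y} → Step x y → Σ[ t ∈ Fin (2 * P) ] cyc t ≡ x × cyc (oneF t) ≡ y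
    step-position (layer s j j<p) = edge-at (offset s + j) (offset+<2P s j<P) (vertexAt-offset s j j<P)
                                            (vertexAt-next-inner s j<p)
      where
        j<P : j < P
        j<P = ℕ.m<n⇒m<1+n j<p
    step-position (rung s) = edge-at (offset s + p) (offset+<2P s (ℕ.n<1+n p)) (vertexAt-offset s p (ℕ.n<1+n p))
                                     (vertexAt-next-last s)

    layer-label : ∀ s j → label (vertex s j) (vertex s (suc j)) ≡ a
    layer-label false j = trans (cong (_- f j) (f-suc j)) (xyx⁻¹≈y (f j) a)
    layer-label true j = begin
      label (vertex true j) (vertex true (suc j))
        ≡⟨ label-layer true (⊖ f j) (⊖ f (suc j)) ⟩
      ⊖ ⊖ f (suc j) - ⊖ ⊖ f j
        ≡⟨ cong₂ _-_ (⁻¹-involutive (f (suc j))) (⁻¹-involutive (f j)) ⟩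
      f (suc j) - f j
        ≡⟨ layer-label false j ⟩
      a ∎

    antipode-R : ∀ s → R (sign s (f p) ⊕ sign s (f p)) ≡ true
    antipode-R s = begin
      R (sign s (f p) ⊕ sign s (f p))   ≡⟨ cong R (sign-homo s (f p) (f p)) ⟨
      R (sign s (f p ⊕ f p))            ≡⟨ R-sign s (f p ⊕ f p) ⟩
      R (f p ⊕ f p)                     ≡⟨ cong R (trans (cong₂ _⊕_ f-p f-p) ⊖c⊕⊖c) ⟩
      R (⊖ a)                           ≡⟨ R-⊖ a ⟩
      R a                               ≡⟨ Ra ⟩
      true                              ∎

    M-antipode : ∀ s → M (vertex s p) ≡ vertex s (suc p)
    M-antipode s = trans (M-layer (antipode-R s)) (cong (s ,_) (begin
      ⊖ sign s (f p)      ≡⟨ cong (⊖_ ∘ sign s) f-p ⟩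
      ⊖ sign s (⊖ c)      ≡⟨ cong ⊖_ (sign-⊖ s c) ⟩
      ⊖ ⊖ sign s c        ≡⟨ ⁻¹-involutive (sign s c) ⟩
      sign s c            ≡⟨ cong (sign s) f-P ⟨
      sign s (f P)        ∎))

    step-adj : ∀ {x y} → Step x y → Prism x y
    step-adj (layer false j _) = trans (cong R (layer-label false j)) Ra
    step-adj (layer true j _) = trans (cong R (layer-label true j)) Ra
    step-adj (rung false) = trans f-p (cong ⊖_ (sym f-0))
    step-adj (rung true) = trans (cong ⊖_ f-p) (trans (⁻¹-involutive c) (sym f-0))

    step-label : ∀ {x y} → Step x y → label x y ≈± a
    step-label (layer s j _) = false , layer-label s j
    step-label (rung false) = true , trans (cong₂ _⊕_ f-p (cong ⊖_ f-0)) ⊖c⊕⊖c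
    step-label (rung true) = false , trans (cong₂ _⊕_ (trans (cong ⊖_ f-p) (⁻¹-involutive c)) f-0) (half-+ a)

    f-antipodal : ∀ j → j < P → f (suc j) ≡ ⊖ f j → j ≡ p
    f-antipodal j j<P f[1+j]≡⊖fj =
      f-injective j<P (ℕ.n<1+n p) (double-injective (f j) (f p) (trans 2fj≡⊖a (sym 2fp≡⊖a)))
      where
        2fj≡⊖a : f j ⊕ f j ≡ ⊖ a
        2fj≡⊖a = inverseˡ-unique (f j ⊕ f j) a (begin
          f j ⊕ f j ⊕ a       ≡⟨ ⊕-assoc (f j) (f j) a ⟩
          f j ⊕ (f j ⊕ a)     ≡⟨ cong (f j ⊕_) (trans (sym (f-suc j)) f[1+j]≡⊖fj) ⟩
          f j ⊕ ⊖ f j         ≡⟨ ⊕-inverseʳ (f j) ⟩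
          𝟘                   ∎)
        2fp≡⊖a : f p ⊕ f p ≡ ⊖ a
        2fp≡⊖a = trans (cong₂ _⊕_ f-p f-p) ⊖c⊕⊖c

    step-∉M : ∀ {x y} → Step x y → ¬ M x ≡ y
    step-∉M (layer s j j<p) M≡ = ℕ.<-irrefl (f-antipodal j (ℕ.m<n⇒m<1+n j<p)
      (sign-injective s (trans (M-same-side M≡) (sym (sign-⊖ s (f j)))))) j<p
    step-∉M (rung s) M≡ = contradiction (trans (sym (antipode-R s)) (M-other-side M≡)) λ ()

    on-layer : ∀ s u n → sign s u ≡ f n → (s , u) ≡ vertex s n
    on-layer s u n eq = cong (s ,_) (trans (sym (sign-involutive s u)) (cong (sign s) eq))

    layer-step : ∀ s u w → sign s w ≡ sign s u ⊕ a → ¬ M (s , u) ≡ (s , w) → Step (s , u) (s , w)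
    layer-step s u w w≡u+a ¬M
      with j , j<P , fj≡ ← f-surjective (sign s u)
      with ℕ.m≤n⇒m<n∨m≡n (ℕ.≤-pred j<P)
    ... | inj₁ j<p =
      subst₂ Step (sym (on-layer s u j (sym fj≡))) (sym (on-layer s w (suc j) w≡f[1+j])) (layer s j j<p)
      where
        w≡f[1+j] : sign s w ≡ f (suc j)
        w≡f[1+j] = trans w≡u+a (trans (cong (_⊕ a) (sym fj≡)) (sym (f-suc j)))
    ... | inj₂ refl = contradiction (subst₂ (λ x y → M x ≡ y) (sym (on-layer s u p (sym fj≡)))
                                      (sym (on-layer s w P w≡fP)) (M-antipode s)) ¬M
      where
        w≡fP : sign s w ≡ f P
        w≡fP = trans w≡u+a (trans (cong (_⊕ a) (sym fj≡)) (sym (f-suc p)))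

    rung-⊖c : Step (false , ⊖ c) (true , ⊖ c)
    rung-⊖c = subst₂ Step (cong (false ,_) f-p) (cong (true ,_) (cong ⊖_ f-0)) (rung false)

    rung-c : Step (true , c) (false , c)
    rung-c = subst₂ Step (cong (true ,_) (trans (cong ⊖_ f-p) (⁻¹-involutive c))) (cong (false ,_) f-0)
                    (rung true)

    halve-sign : ∀ s u → u ⊕ u ≡ sign s a → u ≡ sign s c
    halve-sign s u u+u≡ = double-injective u (sign s c)
      (trans u+u≡ (sym (trans (sym (sign-homo s c c)) (cong (sign s) (half-+ a)))))

    same-layer-step : ∀ s u w → label (s , u) (s , w) ≈± a → ¬ M (s , u) ≡ (s , w) →
                      Step (s , u) (s , w) ⊎ Step (s , w) (s , u)
    same-layer-step s u w (false , eq) ¬M =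
      inj₁ (layer-step s u w (-≡⇒≡+ (sign s u) (sign s w) a (trans (sym (label-layer s u w)) eq)) ¬M)
    same-layer-step s u w (true , eq) ¬M =
      inj₂ (layer-step s w u (-≡⇒≡+ (sign s w) (sign s u) a u-w≡a) (¬M-sym ¬M))
      where
        u-w≡a : sign s u - sign s w ≡ a
        u-w≡a = trans (sym (⁻¹-anti-homo‿- (sign s w) (sign s u)))
                      (trans (cong ⊖_ (trans (sym (label-layer s u w)) eq)) (⁻¹-involutive a))

    edge⇒step : ∀ x y → Prism x y → label x y ≈± a → ¬ M x ≡ y → Step x y ⊎ Step y x
    edge⇒step (false , u) (false , w) _ = same-layer-step false u w
    edge⇒step (true , u) (true , w) _ = same-layer-step true u w
    edge⇒step (false , u) (true , u) refl (false , eq) _ =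
      inj₂ (subst (λ z → Step (true , z) (false , z)) (sym (halve-sign false u eq)) rung-c)
    edge⇒step (false , u) (true , u) refl (true , eq) _ =
      inj₁ (subst (λ z → Step (false , z) (true , z)) (sym (halve-sign true u eq)) rung-⊖c)
    edge⇒step (true , u) (false , u) refl (false , eq) _ =
      inj₁ (subst (λ z → Step (true , z) (false , z)) (sym (halve-sign false u eq)) rung-c)
    edge⇒step (true , u) (false , u) refl (true , eq) _ =
      inj₂ (subst (λ z → Step (false , z) (true , z)) (sym (halve-sign true u eq)) rung-⊖c)

    cycle : HamCycle (2 * P) Prism
    cycle = record { cyc = cyc ; inj = cyc-injective ; adj = step-adj ∘ cyc-step }

    CycleEdge : V → V → Set
    CycleEdge = CycEdge (2 * P) Prism cyc

    cycleEdge-label : ∀ {x y} → CycleEdge x y → label x y ≈± a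
    cycleEdge-label (i , inj₁ (e₁ , e₂)) =
      subst₂ (λ x y → label x y ≈± a) e₁ e₂ (step-label (cyc-step i))
    cycleEdge-label {x} {y} (i , inj₂ (e₁ , e₂)) =
      label-swap y x (subst₂ (λ x y → label x y ≈± a) e₁ e₂ (step-label (cyc-step i)))

    cycleEdge-∉M : ∀ {x y} → CycleEdge x y → ¬ M x ≡ y
    cycleEdge-∉M (i , inj₁ (e₁ , e₂)) = subst₂ (λ x y → ¬ M x ≡ y) e₁ e₂ (step-∉M (cyc-step i))
    cycleEdge-∉M (i , inj₂ (e₁ , e₂)) =
      ¬M-sym (subst₂ (λ x y → ¬ M x ≡ y) e₁ e₂ (step-∉M (cyc-step i)))

    step⇒cycleEdge : ∀ {x y} → Step x y ⊎ Step y x → CycleEdge x y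
    step⇒cycleEdge (inj₁ st) = let t , e₁ , e₂ = step-position st in t , inj₁ (e₁ , e₂)
    step⇒cycleEdge (inj₂ st) = let t , e₁ , e₂ = step-position st in t , inj₂ (e₁ , e₂)

  module RepCycle (q : Fin m) = Cycle (A q) (A-R q)

  cycles : Fin m → HamCycle (2 * P) Prism
  cycles q = RepCycle.cycle q

  rung-R : ∀ s u → ¬ M (s , u) ≡ (not s , u) → R (u ⊕ u) ≡ true
  rung-R s u ¬M with R (u ⊕ u)
  ... | true = refl
  ... | false = contradiction refl ¬M

  edge-label-R : ∀ x y → Prism x y → ¬ M x ≡ y → R (label x y) ≡ true
  edge-label-R (false , u) (false , w) adj _ = adj
  edge-label-R (true , u) (true , w) adj _ = adj
  edge-label-R (false , u) (true , u) refl ¬M = rung-R false u ¬M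
  edge-label-R (true , u) (false , u) refl ¬M = rung-R true u ¬M

  Part : V → V → Maybe (Fin m) → Set
  Part x y q = InPart (2 * P) Prism cycles true M q x y

  cover : ∀ x y → Prism x y → Σ (Maybe (Fin m)) (Part x y)
  cover x y adj with ≡-dec Bool._≟_ Fin._≟_ (M x) y
  ... | yes Mx≡y = nothing , refl , Mx≡y
  ... | no Mx≢y =
    let q , label≈±Aq = classify (label x y) (edge-label-R x y adj Mx≢y)
    in just q , RepCycle.step⇒cycleEdge q (RepCycle.edge⇒step q x y adj label≈±Aq Mx≢y)

  unique : ∀ x y → Prism x y → ∀ q r → Part x y q → Part x y r → q ≡ r
  unique x y _ (just q) (just r) e₁ e₂ =
    cong just (classify-unique q r (RepCycle.cycleEdge-label q e₁) (RepCycle.cycleEdge-label r e₂))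
  unique x y _ (just q) nothing e₁ (_ , Mx≡y) = contradiction Mx≡y (RepCycle.cycleEdge-∉M q e₁)
  unique x y _ nothing (just r) (_ , Mx≡y) e₂ = contradiction Mx≡y (RepCycle.cycleEdge-∉M r e₂)
  unique x y _ nothing nothing _ _ = refl

  decomposition : HamDecomposition (2 * P) Prism (suc (count R))
  decomposition = record
    { m = m
    ; cycles = cycles
    ; hasM = true
    ; M = M
    ; M-inv = λ _ → M-involutive
    ; M-nofix = λ _ → M-nofix
    ; M-adj = λ _ → M-adj
    ; count-even = λ ()
    ; count-odd = λ _ → cong suc count-R
    ; cover = cover
    ; unique = unique
    }

module Cayley (p : ℕ) (P-prime : Prime (suc p)) (3≤P : suc p ≥ 3) (S : D (suc p) → Bool)
              (S-e : S e ≡ false) (S-inv : ∀ g → S (inv g) ≡ S g) (card₁ : card (reflPart S) ≡ 1) where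
  open Cyclic p
  open ≡-Reasoning

  rot : Z → Bool
  rot x = S (false , x)

  open CirculantPrism p P-prime 3≤P rot (λ x → S-inv (false , x)) S-e

  reflection-count : count (S ∘ (true ,_)) ≡ 1
  reflection-count = begin
    count (S ∘ (true ,_))                   ≡⟨ count-cong (λ i → ∧-identityʳ (S (true , i))) ⟨
    count (reflPart S ∘ (true ,_))          ≡⟨ cong (_+ count (reflPart S ∘ (true ,_))) no-rotations ⟨
    count (reflPart S ∘ (false ,_))
      + count (reflPart S ∘ (true ,_))      ≡⟨ card-split (reflPart S) ⟨
    card (reflPart S)                       ≡⟨ card₁ ⟩
    1                                       ∎
    where
      no-rotations : count (reflPart S ∘ (false ,_)) ≡ 0
      no-rotations = trans (count-cong (λ i → ∧-zeroʳ (S (false , i)))) (count-false P)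

  card-S : card S ≡ suc (count rot)
  card-S = trans (card-split S) (trans (cong (count rot +_) reflection-count) (ℕ.+-comm (count rot) 1))

  k : Z
  k = proj₁ (count-≡1 (S ∘ (true ,_)) reflection-count)

  S-k : S (true , k) ≡ true
  S-k = proj₁ (proj₂ (count-≡1 (S ∘ (true ,_)) reflection-count))

  k-unique : ∀ x → S (true , x) ≡ true → x ≡ k
  k-unique = proj₂ (proj₂ (count-≡1 (S ∘ (true ,_)) reflection-count))

  -- βα^(x+k) becomes (true , x), so that the reflection βα^k joins α^x to (true , x).
  φ : V → D P
  φ (false , x) = false , x
  φ (true , x) = true , x ⊕ k

  ψ : D P → V
  ψ (false , y) = false , y
  ψ (true , y) = true , y - k

  ψ∘φ : ∀ x → ψ (φ x) ≡ x
  ψ∘φ (false , x) = refl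
  ψ∘φ (true , x) = cong (true ,_) (//-rightDividesʳ k x)

  φ∘ψ : ∀ y → φ (ψ y) ≡ y
  φ∘ψ (false , y) = refl
  φ∘ψ (true , y) = cong (true ,_) (//-rightDividesˡ k y)

  rung⇒S : ∀ u → S (true , (u ⊕ k) - u) ≡ true
  rung⇒S u = trans (cong (λ z → S (true , z)) (xyx⁻¹≈y u k)) S-k

  S⇒rung : ∀ u w → S (true , (w ⊕ k) - u) ≡ true → u ≡ w
  S⇒rung u w S≡ = ∙-cancelʳ k u w (sym (-≡⇒≡+ u (w ⊕ k) k (k-unique _ S≡)))

  lower-difference : ∀ u w → ⊖ (w ⊕ k) ⊕ (u ⊕ k) ≡ u - w
  lower-difference u w = trans (⊕-comm (⊖ (w ⊕ k)) (u ⊕ k)) ([x⊕z]-[y⊕z]≡x-y u w k)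

  prism⇒cayley : ∀ {x y} → Prism x y → CayAdj S (φ x) (φ y)
  prism⇒cayley {false , u} {false , w} adj = adj
  prism⇒cayley {true , u} {true , w} adj = trans (cong rot (lower-difference u w)) adj
  prism⇒cayley {false , u} {true , u} refl = rung⇒S u
  prism⇒cayley {true , u} {false , u} refl =
    trans (cong (λ z → S (true , z)) (⊕-comm (⊖ u) (u ⊕ k))) (rung⇒S u)

  cayley⇒prism : ∀ {x y} → CayAdj S (φ x) (φ y) → Prism x y
  cayley⇒prism {false , u} {false , w} adj = adj
  cayley⇒prism {true , u} {true , w} adj = trans (cong rot (sym (lower-difference u w))) adj
  cayley⇒prism {false , u} {true , w} adj = S⇒rung u w adj
  cayley⇒prism {true , w} {false , u} adj =
    sym (S⇒rung u w (trans (cong (λ z → S (true , z)) (⊕-comm (w ⊕ k) (⊖ u))) adj))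

  hamiltonDecomposition : HasHamiltonDecomposition S
  hamiltonDecomposition = subst (HamDecomposition (2 * P) (CayAdj S)) (sym card-S)
    (Transport.transport (2 * P) Prism (CayAdj S) φ ψ ψ∘φ φ∘ψ prism⇒cayley cayley⇒prism decomposition)

lemma1 : (p : ℕ) → Prime (suc p) → suc p ≥ 3
         → (S : D (suc p) → Bool)
         → S e ≡ false
         → (∀ g → S (inv g) ≡ S g)
         → Generates S
         → card (reflPart S) ≡ 1
         → HasHamiltonDecomposition S
lemma1 p P-prime 3≤P S S-e S-inv _ card₁ = Cayley.hamiltonDecomposition p P-prime 3≤P S S-e S-inv card₁
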